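{- If $k$ is an odd positive integer, then there exists a finite, simple, connected, cubic, arc-transitive $k$-circulant with exactly $6k^2$ vertices.
   Context: A permutation group is semiregular if its only element fixing a point is the identity. For an integer $k\geq 1$, a graph is a $k$-circulant if its automorphism group contains a cyclic semiregular subgroup with exactly $k$ orbits on the vertices. A graph is cubic if every vertex has degree $3$, and arc-transitive if its automorphism group acts transitively on ordered pairs of adjacent vertices. -}

module Defs where

open import Data.Nat using (ℕ; zero; suc)
open import Data.Bool using (Bool; true; false)
open import Data.Fin using (Fin)
open import Data.List using (List; length; filterᵇ; allFin)
open import Data.Product using (Σ; ∃; _×_; _,_)
open import Data.Fin.Permutation using (Permutation′; _⟨$⟩ʳ_)
open import Relation.Binary.PropositionalEquality using (_≡_)

record Graph (n : ℕ) : Set where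
  field
    adj       : Fin n → Fin n → Bool
    symmetric : ∀ u v → adj u v ≡ adj v u
    loopless  : ∀ v → adj v v ≡ false
open Graph public

degree : ∀ {n} → Graph n → Fin n → ℕ
degree G v = length (filterᵇ (adj G v) (allFin _))

Cubic : ∀ {n} → Graph n → Set
Cubic G = ∀ v → degree G v ≡ 3

data Walk {n} (G : Graph n) : Fin n → Fin n → Set where
  here : ∀ {u} → Walk G u u
  step : ∀ {u w v} → adj G u w ≡ true → Walk G w v → Walk G u v

Connected : ∀ {n} → Graph n → Set
Connected G = ∀ u v → Walk G u v

IsAutomorphism : ∀ {n} → Graph n → Permutation′ n → Set
IsAutomorphism G σ = ∀ u v → adj G (σ ⟨$⟩ʳ u) (σ ⟨$⟩ʳ v) ≡ adj G u v

ArcTransitive : ∀ {n} → Graph n → Set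
ArcTransitive G = ∀ u v x y → adj G u v ≡ true → adj G x y ≡ true →
  Σ (Permutation′ _) λ σ → IsAutomorphism G σ × (σ ⟨$⟩ʳ u ≡ x) × (σ ⟨$⟩ʳ v ≡ y)

pow : ∀ {n} → Permutation′ n → ℕ → Fin n → Fin n
pow σ zero    v = v
pow σ (suc i) v = σ ⟨$⟩ʳ (pow σ i v)

CyclicSemiregular : ∀ {n} → Permutation′ n → Set
CyclicSemiregular ρ = ∀ i v → pow ρ i v ≡ v → ∀ w → pow ρ i w ≡ w

-- ⟨ρ⟩ has exactly k orbits: there is a transversal reps : Fin k → Fin n,
-- i.e. every vertex lies in the orbit of some representative, and
-- representatives lying in the same orbit are equal.
HasExactlyOrbits : ∀ {n} → ℕ → Permutation′ n → Set
HasExactlyOrbits {n} k ρ = Σ (Fin k → Fin n) λ reps →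
  (∀ v → ∃ λ (i : ℕ) → ∃ λ (j : Fin k) → pow ρ i (reps j) ≡ v) ×
  (∀ i j j′ → pow ρ i (reps j) ≡ reps j′ → j ≡ j′)

Circulant : ∀ {n} → ℕ → Graph n → Set
Circulant k G = Σ (Permutation′ _) λ ρ →
  IsAutomorphism G ρ × CyclicSemiregular ρ × HasExactlyOrbits k ρ

-- The graph is the hexagonal tessellation of the torus ℤ²/L, L = ℤ(3k, 0) + ℤ(k, k):
-- a black and a white copy of ℤ²/L (3k² cells each), the black cell a being joined to
-- the white cells a, a - (1, 0) and a - (0, 1).  It is the union of three perfect
-- matchings, hence cubic, and moving along them connects any two cells.  Each arc is the
-- image of one base arc under an affine map x ↦ M x + t whose linear part M is a symmetry
-- of the tessellation; these M preserve L, so the maps descend to the torus.  The glide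
-- reflection ρ(x, y) = (-y, -x) + (1, 0) exchanges the colours and ρ² is the translation
-- by (1, -1): odd powers of ρ fix no vertex, and a translation fixing one vertex fixes
-- all.  The black cells (0, r), 0 ≤ r < k, meet every orbit of ⟨ρ⟩ exactly once.

module Submission where

open import Defs
open import Data.Nat as ℕ using (ℕ; zero; suc; NonZero; _%_)
import Data.Nat.Properties as ℕ
import Data.Nat.Divisibility as ℕ
open import Data.Nat.DivMod using (m<n⇒m%n≡m)
open import Data.Nat.Tactic.RingSolver renaming (solve-∀ to ℕ-solve-∀)
open import Data.Integer as ℤ using (ℤ; +_; -[1+_]; +[1+_]; -1ℤ; _+_; _*_; -_; _-_)
import Data.Integer.Properties as ℤ
open import Data.Integer.DivMod using (n%ℕd<d; a≡a%ℕn+[a/ℕn]*n)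
open import Data.Integer.Divisibility.Signed
open import Data.Integer.Tactic.RingSolver using (solve-∀)
open import Data.Bool using (Bool; true; false; not; _∨_; _xor_; T)
open import Data.Bool.Properties using (xor-assoc; xor-same; xor-identityʳ; xor-comm; not-distribˡ-xor; not-¬)
open import Data.Fin as Fin using (Fin; toℕ; fromℕ<)
import Data.Fin.Properties as Fin
open import Data.Fin.Patterns using (0F; 1F; 2F)
open import Data.Fin.Permutation as Perm using (Permutation′; _⟨$⟩ʳ_; _⟨$⟩ˡ_; _∘ₚ_; inverseˡ; inverseʳ; transpose)
open import Data.List using ([]; _∷_; length; filterᵇ; allFin)
open import Data.List.Properties using (filter-none)
open import Data.List.Membership.Propositional using (_∈_)
open import Data.List.Membership.Propositional.Properties using (∈-allFin)
open import Data.List.Relation.Unary.All as All using (All; []; _∷_)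
open import Data.List.Relation.Unary.Any using (here; there)
open import Data.List.Relation.Unary.Unique.Propositional using (Unique; []; _∷_)
open import Data.List.Relation.Unary.Unique.Propositional.Properties using (allFin⁺)
open import Data.Product using (Σ; ∃-syntax; _×_; _,_; proj₁; proj₂)
open import Data.Product.Function.NonDependent.Propositional using (_×-↔_)
open import Data.Empty using (⊥-elim)
open import Function using (_↔_; _⇔_; mk⇔; mk↔ₛ′; Inverse; Equivalence; Injection; _∘_)
open import Function.Properties.Inverse using (↔⇒↣)
open import Function.Construct.Composition using (_↔-∘_)
open import Function.Construct.Symmetry using (↔-sym)
open import Relation.Binary.PropositionalEquality
open import Relation.Binary.Bundles using (Setoid)
open import Relation.Binary.Definitions using (DecidableEquality)
import Relation.Binary.Reasoning.Setoid as SetoidReasoning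
open import Relation.Nullary using (Dec; does; yes; contradiction)
open import Relation.Nullary.Decidable using (T?; dec-true; dec-false; does-⇔)

infix 4 _≡_[mod_]
record _≡_[mod_] (a b : ℤ) (n : ℕ) : Set where
  constructor mod
  field divides-difference : + n ∣ a - b

mod-≡ : ∀ {n a b} → a ≡ b → a ≡ b [mod n ]
mod-≡ {n} {a} refl = mod (divides (+ 0) (ℤ.+-inverseʳ a))

mod-resp : ∀ {n a a′ b b′} → a ≡ a′ → b ≡ b′ → a ≡ b [mod n ] → a′ ≡ b′ [mod n ]
mod-resp refl refl p = p

mod-sym : ∀ {n a b} → a ≡ b [mod n ] → b ≡ a [mod n ]
mod-sym {n} {a} {b} (mod p) = mod (subst (+ n ∣_) (lemma a b) (∣m⇒∣-m p))
  where lemma : ∀ a b → - (a - b) ≡ b - a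
        lemma = solve-∀

mod-+ : ∀ {n a b c d} → a ≡ b [mod n ] → c ≡ d [mod n ] → a + c ≡ b + d [mod n ]
mod-+ {n} {a} {b} {c} {d} (mod p) (mod q) = mod (subst (+ n ∣_) (lemma a b c d) (∣m∣n⇒∣m+n p q))
  where lemma : ∀ a b c d → (a - b) + (c - d) ≡ (a + c) - (b + d)
        lemma = solve-∀

mod-trans : ∀ {n a b c} → a ≡ b [mod n ] → b ≡ c [mod n ] → a ≡ c [mod n ]
mod-trans {n} {a} {b} {c} (mod p) (mod q) = mod (subst (+ n ∣_) (lemma a b c) (∣m∣n⇒∣m+n p q))
  where lemma : ∀ a b c → (a - b) + (b - c) ≡ a - c
        lemma = solve-∀

mod-neg : ∀ {n a b} → a ≡ b [mod n ] → - a ≡ - b [mod n ]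
mod-neg {n} {a} {b} (mod p) = mod (subst (+ n ∣_) (lemma a b) (∣m⇒∣-m p))
  where lemma : ∀ a b → - (a - b) ≡ - a - - b
        lemma = solve-∀

mod-- : ∀ {n a b c d} → a ≡ b [mod n ] → c ≡ d [mod n ] → a - c ≡ b - d [mod n ]
mod-- p q = mod-+ p (mod-neg q)

mod-*ˡ : ∀ {n a b} m → a ≡ b [mod n ] → m * a ≡ m * b [mod n ]
mod-*ˡ {n} {a} {b} m (mod p) = mod (subst (+ n ∣_) (lemma m a b) (∣n⇒∣m*n m p))
  where lemma : ∀ m a b → m * (a - b) ≡ m * a - m * b
        lemma = solve-∀

mod-∣ : ∀ {m n a b} → m ℕ.∣ n → a ≡ b [mod n ] → a ≡ b [mod m ]
mod-∣ m∣n (mod p) = mod (∣-trans (∣ᵤ⇒∣ m∣n) p)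

mod-scale : ∀ {n a b} m → a ≡ b [mod n ] → + m * a ≡ + m * b [mod m ℕ.* n ]
mod-scale {n} {a} {b} m (mod p) = mod (subst₂ _∣_ (sym (ℤ.pos-* m n)) (lemma (+ m) a b) (*-monoʳ-∣ (+ m) p))
  where lemma : ∀ m a b → m * (a - b) ≡ m * a - m * b
        lemma = solve-∀

mod⇒≡ : ∀ {n a b} → a ≡ b [mod n ] → ∃[ q ] a ≡ b + q * + n
mod⇒≡ {n} {a} {b} (mod (divides q eq)) = q , trans (lemma a b) (cong (λ m → b + m) eq)
  where lemma : ∀ a b → a ≡ b + (a - b)
        lemma = solve-∀

≡⇒mod : ∀ {n a b} q → a ≡ b + q * + n → a ≡ b [mod n ]
≡⇒mod {n} {a} {b} q refl = mod (divides q (lemma b (q * + n)))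
  where lemma : ∀ b m → b + m - b ≡ m
        lemma = solve-∀

toℤ : ∀ {n} → Fin n → ℤ
toℤ i = + toℕ i

reduce : (n : ℕ) .{{_ : NonZero n}} → ℤ → Fin n
reduce n a = fromℕ< (n%ℕd<d a n)

toℤ-reduce : ∀ n .{{_ : NonZero n}} a → toℤ (reduce n a) ≡ a [mod n ]
toℤ-reduce n a = mod-sym (≡⇒mod (a ℤ./ℕ n) (trans (a≡a%ℕn+[a/ℕn]*n a n)
  (cong (λ r → + r + (a ℤ./ℕ n) * + n) (sym (Fin.toℕ-fromℕ< (n%ℕd<d a n))))))

private
  multiple-≤ : ∀ {n x y} m → + x ≡ + y + + suc m * + n → n ℕ.≤ x
  multiple-≤ {n} {x} {y} m eq = begin
    n                  ≤⟨ ℕ.≤-trans (ℕ.m≤m+n n (m ℕ.* n)) (ℕ.m≤n+m _ y) ⟩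
    y ℕ.+ suc m ℕ.* n  ≡⟨ ℤ.+-injective (sym (trans eq (cong (λ z → + y + z) (sym (ℤ.pos-* (suc m) n))))) ⟩
    x                  ∎
    where open ℕ.≤-Reasoning

-- Only the quotient 0 keeps both remainders inside [0, n).
remainder-unique : ∀ {n r s} → r ℕ.< n → s ℕ.< n → + r ≡ + s [mod n ] → r ≡ s
remainder-unique {n} {r} {s} r<n s<n r≡s with mod⇒≡ r≡s
... | + zero   , eq = ℤ.+-injective (trans eq (lemma (+ s) (+ n)))
  where lemma : ∀ s n → s + + 0 * n ≡ s
        lemma = solve-∀
... | +[1+ m ] , eq = ⊥-elim (ℕ.<⇒≱ r<n (multiple-≤ m eq))
... | -[1+ m ] , eq = ⊥-elim (ℕ.<⇒≱ s<n (multiple-≤ m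
  (trans (lemma (+ s) +[1+ m ] (+ n)) (cong (λ z → z + +[1+ m ] * + n) (sym eq)))))
  where lemma : ∀ s c n → s ≡ (s + - c * n) + c * n
        lemma = solve-∀

reduce-cong : ∀ n .{{_ : NonZero n}} {a b} → a ≡ b [mod n ] → reduce n a ≡ reduce n b
reduce-cong n {a} {b} p = Fin.toℕ-injective (remainder-unique (Fin.toℕ<n (reduce n a)) (Fin.toℕ<n (reduce n b))
  (mod-trans (toℤ-reduce n a) (mod-trans p (mod-sym (toℤ-reduce n b)))))

reduce-injective : ∀ n .{{_ : NonZero n}} {a b} → reduce n a ≡ reduce n b → a ≡ b [mod n ]
reduce-injective n {a} {b} p =
  mod-trans (mod-sym (toℤ-reduce n a)) (subst (λ r → toℤ r ≡ b [mod n ]) (sym p) (toℤ-reduce n b))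

reduce-toℤ : ∀ n .{{_ : NonZero n}} (i : Fin n) → reduce n (toℤ i) ≡ i
reduce-toℤ n i = Fin.toℕ-injective (trans (Fin.toℕ-fromℕ< _) (m<n⇒m%n≡m (Fin.toℕ<n i)))

module _ {n} {G : Graph n} where

  infixr 5 _++ʷ_
  _++ʷ_ : ∀ {u v w} → Walk G u v → Walk G v w → Walk G u w
  here       ++ʷ q = q
  step e p   ++ʷ q = step e (p ++ʷ q)

  reverseʷ : ∀ {u v} → Walk G u v → Walk G v u
  reverseʷ here                    = here
  reverseʷ (step {u} {w} e p) = reverseʷ p ++ʷ step (trans (symmetric G w u) e) here

module _ {n} (G : Graph n) where

  connected-from : ∀ x → (∀ v → Walk G x v) → Connected G
  connected-from x walk u v = reverseʷ (walk u) ++ʷ walk v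

  ∘-isAutomorphism : ∀ σ τ → IsAutomorphism G σ → IsAutomorphism G τ → IsAutomorphism G (σ ∘ₚ τ)
  ∘-isAutomorphism σ τ σ-auto τ-auto u v = trans (τ-auto (σ ⟨$⟩ʳ u) (σ ⟨$⟩ʳ v)) (σ-auto u v)

  flip-isAutomorphism : ∀ σ → IsAutomorphism G σ → IsAutomorphism G (Perm.flip σ)
  flip-isAutomorphism σ σ-auto u v =
    trans (sym (σ-auto (σ ⟨$⟩ˡ u) (σ ⟨$⟩ˡ v))) (cong₂ (adj G) (inverseʳ σ) (inverseʳ σ))

  arcTransitive-from : ∀ x₀ y₀ →
    (∀ u v → adj G u v ≡ true →
      Σ (Permutation′ n) λ σ → IsAutomorphism G σ × σ ⟨$⟩ʳ x₀ ≡ u × σ ⟨$⟩ʳ y₀ ≡ v) →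
    ArcTransitive G
  arcTransitive-from x₀ y₀ onto u v x y uv xy with onto u v uv | onto x y xy
  ... | σ , σ-auto , σx₀ , σy₀ | τ , τ-auto , τx₀ , τy₀ =
    Perm.flip σ ∘ₚ τ , ∘-isAutomorphism (Perm.flip σ) τ (flip-isAutomorphism σ σ-auto) τ-auto ,
    back σx₀ τx₀ , back σy₀ τy₀
    where
    back : ∀ {z w t} → σ ⟨$⟩ʳ z ≡ w → τ ⟨$⟩ʳ z ≡ t → τ ⟨$⟩ʳ (σ ⟨$⟩ˡ w) ≡ t
    back {z} refl τz = trans (cong (τ ⟨$⟩ʳ_) (inverseˡ σ {z})) τz

module _ {A : Set} where

  length-filterᵇ-∨ : (p q : A → Bool) → (∀ x → p x ≡ true → q x ≡ false) → ∀ xs →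
    length (filterᵇ (λ x → p x ∨ q x) xs) ≡ length (filterᵇ p xs) ℕ.+ length (filterᵇ q xs)
  length-filterᵇ-∨ p q disjoint []       = refl
  length-filterᵇ-∨ p q disjoint (x ∷ xs) with p x in px | q x in qx
  ... | true  | true  = contradiction (trans (sym (disjoint x px)) qx) λ ()
  ... | true  | false = cong suc (length-filterᵇ-∨ p q disjoint xs)
  ... | false | true  = trans (cong suc (length-filterᵇ-∨ p q disjoint xs)) (sym (ℕ.+-suc _ _))
  ... | false | false = length-filterᵇ-∨ p q disjoint xs

  length-filterᵇ-none : ∀ (p : A → Bool) {xs} → All (λ x → p x ≡ false) xs → length (filterᵇ p xs) ≡ 0
  length-filterᵇ-none p none = cong length (filter-none (T? ∘ p) (All.map (subst T) none))

  module _ (_≟_ : DecidableEquality A) where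

    length-filterᵇ-≟ : ∀ {a xs} → Unique xs → a ∈ xs → length (filterᵇ (λ x → does (x ≟ a)) xs) ≡ 1
    length-filterᵇ-≟ {a} (a∉xs ∷ _) (here refl) rewrite dec-true (a ≟ a) refl =
      cong suc (length-filterᵇ-none _ (All.map (λ a≢y → dec-false (_ ≟ a) (a≢y ∘ sym)) a∉xs))
    length-filterᵇ-≟ {a} {x ∷ _} (x∉xs ∷ unique) (there a∈xs) rewrite dec-false (x ≟ a) (All.lookup x∉xs a∈xs) =
      length-filterᵇ-≟ unique a∈xs

witness : ∀ {A : Set} (a? : Dec A) → does a? ≡ true → A
witness (yes a) _ = a

length-filterᵇ-image : ∀ {d n} (f : Fin d → Fin n) → (∀ {s t} → f s ≡ f t → s ≡ t) →
  length (filterᵇ (λ j → does (Fin.any? λ s → j Fin.≟ f s)) (allFin n)) ≡ d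
length-filterᵇ-image {zero}  {n} f f-injective = length-filterᵇ-none _ (All.universal (λ _ → refl) (allFin n))
length-filterᵇ-image {suc d} {n} f f-injective = begin
  length (filterᵇ (λ j → does (j Fin.≟ f 0F) ∨ does (Fin.any? λ s → j Fin.≟ f (Fin.suc s))) (allFin n))
    ≡⟨ length-filterᵇ-∨ _ _ disjoint (allFin n) ⟩
  length (filterᵇ (λ j → does (j Fin.≟ f 0F)) (allFin n)) ℕ.+
  length (filterᵇ (λ j → does (Fin.any? λ s → j Fin.≟ f (Fin.suc s))) (allFin n))
    ≡⟨ cong₂ ℕ._+_ (length-filterᵇ-≟ Fin._≟_ (allFin⁺ n) (∈-allFin (f 0F)))
                   (length-filterᵇ-image (f ∘ Fin.suc) (Fin.suc-injective ∘ f-injective)) ⟩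
  suc d ∎
  where
  open ≡-Reasoning
  disjoint : ∀ j → does (j Fin.≟ f 0F) ≡ true → does (Fin.any? λ s → j Fin.≟ f (Fin.suc s)) ≡ false
  disjoint j j≡f0 = dec-false (Fin.any? λ s → j Fin.≟ f (Fin.suc s))
    λ (s , j≡fs) → 0≢suc (f-injective (trans (sym (witness (j Fin.≟ f 0F) j≡f0)) j≡fs))
    where 0≢suc : ∀ {s} → 0F ≢ Fin.suc {d} s
          0≢suc ()

module MatchingGraph {V : Set} {d n : ℕ} (enumeration : Fin n ↔ V)
  (match : Fin d → V → V)
  (match-involutive : ∀ s v → match s (match s v) ≡ v)
  (match-irreflexive : ∀ s v → match s v ≢ v)
  (match-injective : ∀ v {s t} → match s v ≡ match t v → s ≡ t)
  where

  open Inverse enumeration public using () renaming (to to vertex; from to index;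
    strictlyInverseˡ to vertex-index; strictlyInverseʳ to index-vertex)

  private
    partner : Fin d → Fin n → Fin n
    partner s i = index (match s (vertex i))

    Adjacent : Fin n → Fin n → Set
    Adjacent i j = ∃[ s ] j ≡ partner s i

    adjacent? : ∀ i j → Dec (Adjacent i j)
    adjacent? i j = Fin.any? λ s → j Fin.≟ partner s i

    vertex-partner : ∀ s i → vertex (partner s i) ≡ match s (vertex i)
    vertex-partner s i = vertex-index _

    adjacent-sym : ∀ {i j} → Adjacent i j → Adjacent j i
    adjacent-sym {i} (s , refl) =
      s , sym (trans (cong (index ∘ match s) (vertex-partner s i)) (trans (cong index (match-involutive s _)) (index-vertex i)))

    adjacent⇔ : ∀ {i j} → Adjacent i j ⇔ (∃[ s ] vertex j ≡ match s (vertex i))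
    adjacent⇔ {i} {j} = mk⇔
      (λ (s , j≡) → s , trans (cong vertex j≡) (vertex-partner s i))
      (λ (s , vj≡) → s , trans (sym (index-vertex j)) (cong index vj≡))

  graph : Graph n
  graph = record
    { adj       = λ i j → does (adjacent? i j)
    ; symmetric = λ i j → does-⇔ (mk⇔ adjacent-sym adjacent-sym) (adjacent? i j) (adjacent? j i)
    ; loopless  = λ i → dec-false (adjacent? i i) λ (s , i≡) →
        match-irreflexive s (vertex i) (sym (trans (cong vertex i≡) (vertex-partner s i)))
    }

  degree-graph : ∀ i → degree graph i ≡ d
  degree-graph i = length-filterᵇ-image (λ s → partner s i)
    λ e → match-injective (vertex i) (trans (sym (vertex-partner _ i)) (trans (cong vertex e) (vertex-partner _ i)))

  adj-match : ∀ s v → adj graph (index v) (index (match s v)) ≡ true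
  adj-match s v = dec-true (adjacent? _ _)
    (Equivalence.from adjacent⇔ (s , trans (vertex-index _) (cong (match s) (sym (vertex-index v)))))

  adj⇒match : ∀ {i j} → adj graph i j ≡ true → ∃[ s ] vertex j ≡ match s (vertex i)
  adj⇒match {i} {j} e = Equivalence.to adjacent⇔ (witness (adjacent? i j) e)

  lift : V ↔ V → Permutation′ n
  lift f = ↔-sym enumeration ↔-∘ (f ↔-∘ enumeration)

  lift-index : ∀ f v → lift f ⟨$⟩ʳ index v ≡ index (Inverse.to f v)
  lift-index f v = cong (index ∘ Inverse.to f) (vertex-index v)

  module _ (f : V ↔ V) (π : Permutation′ d) where
    open Inverse f using (to)
    open Injection (↔⇒↣ f) using (injective)

    lift-isAutomorphism : (∀ s v → to (match s v) ≡ match (π ⟨$⟩ʳ s) (to v)) → IsAutomorphism graph (lift f)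
    lift-isAutomorphism commutes i j = does-⇔ (mk⇔ forth back) (adjacent? _ _) (adjacent? i j)
      where
      vertex-lift : ∀ i → vertex (lift f ⟨$⟩ʳ i) ≡ to (vertex i)
      vertex-lift i = vertex-index _
      forth : Adjacent (lift f ⟨$⟩ʳ i) (lift f ⟨$⟩ʳ j) → Adjacent i j
      forth a with Equivalence.to adjacent⇔ a
      ... | s , e = Equivalence.from adjacent⇔ (π ⟨$⟩ˡ s , injective (begin
        to (vertex j)                                   ≡⟨ vertex-lift j ⟨
        vertex (lift f ⟨$⟩ʳ j)                          ≡⟨ e ⟩
        match s (vertex (lift f ⟨$⟩ʳ i))                ≡⟨ cong₂ match (inverseʳ π) (sym (vertex-lift i)) ⟨
        match (π ⟨$⟩ʳ (π ⟨$⟩ˡ s)) (to (vertex i))       ≡⟨ commutes (π ⟨$⟩ˡ s) (vertex i) ⟨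
        to (match (π ⟨$⟩ˡ s) (vertex i))                ∎))
        where open ≡-Reasoning
      back : Adjacent i j → Adjacent (lift f ⟨$⟩ʳ i) (lift f ⟨$⟩ʳ j)
      back a with Equivalence.to adjacent⇔ a
      ... | t , e = Equivalence.from adjacent⇔ (π ⟨$⟩ʳ t , (begin
        vertex (lift f ⟨$⟩ʳ j) ≡⟨ vertex-lift j ⟩
        to (vertex j)          ≡⟨ cong to e ⟩
        to (match t (vertex i)) ≡⟨ commutes t (vertex i) ⟩
        match (π ⟨$⟩ʳ t) (to (vertex i)) ≡⟨ cong (match _) (sym (vertex-lift i)) ⟩
        match (π ⟨$⟩ʳ t) (vertex (lift f ⟨$⟩ʳ i)) ∎))
        where open ≡-Reasoning

data Parity : ℕ → Set where
  even : ∀ j → Parity (j ℕ.* 2)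
  odd  : ∀ j → Parity (suc (j ℕ.* 2))

parity : ∀ i → Parity i
parity zero = even 0
parity (suc i) with parity i
... | even j = odd j
... | odd  j = even (suc j)

module Honeycomb (k : ℕ) .{{_ : NonZero k}} where

  instance
    3k-nonZero : NonZero (3 ℕ.* k)
    3k-nonZero = ℕ.m*n≢0 3 k

  record Point : Set where
    constructor ⟨_,_⟩
    field
      x y : ℤ
  open Point

  point-≡ : ∀ {P Q} → x P ≡ x Q → y P ≡ y Q → P ≡ Q
  point-≡ refl refl = refl

  coordinatewise₂ : ∀ {f g : ℤ → ℤ → ℤ} → (∀ a b → f a b ≡ g a b) → ∀ P Q →
    ⟨ f (x P) (x Q) , f (y P) (y Q) ⟩ ≡ ⟨ g (x P) (x Q) , g (y P) (y Q) ⟩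
  coordinatewise₂ eq P Q = point-≡ (eq (x P) (x Q)) (eq (y P) (y Q))

  coordinatewise₃ : ∀ {f g : ℤ → ℤ → ℤ → ℤ} → (∀ a b c → f a b c ≡ g a b c) → ∀ P Q R →
    ⟨ f (x P) (x Q) (x R) , f (y P) (y Q) (y R) ⟩ ≡ ⟨ g (x P) (x Q) (x R) , g (y P) (y Q) (y R) ⟩
  coordinatewise₃ eq P Q R = point-≡ (eq (x P) (x Q) (x R)) (eq (y P) (y Q) (y R))

  coordinatewise₄ : ∀ {f g : ℤ → ℤ → ℤ → ℤ → ℤ} → (∀ a b c d → f a b c d ≡ g a b c d) → ∀ P Q R T →
    ⟨ f (x P) (x Q) (x R) (x T) , f (y P) (y Q) (y R) (y T) ⟩ ≡
    ⟨ g (x P) (x Q) (x R) (x T) , g (y P) (y Q) (y R) (y T) ⟩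
  coordinatewise₄ eq P Q R T = point-≡ (eq (x P) (x Q) (x R) (x T)) (eq (y P) (y Q) (y R) (y T))

  origin : Point
  origin = ⟨ + 0 , + 0 ⟩

  infixl 6 _⊕_ _⊖_
  _⊕_ _⊖_ : Point → Point → Point
  P ⊕ Q = ⟨ x P + x Q , y P + y Q ⟩
  P ⊖ Q = ⟨ x P - x Q , y P - y Q ⟩

  signed : Bool → Point → Point
  signed false P = P
  signed true  P = ⟨ - x P , - y P ⟩

  -- Congruence modulo the lattice L = ℤ(3k, 0) + ℤ(k, k), read off through the
  -- isomorphism ℤ²/L ≅ ℤ/3k × ℤ/k, (x, y) ↦ (x - y, y).
  infix 4 _≈_
  record _≈_ (P Q : Point) : Set where
    constructor mk≈
    field
      diagonal : x P - y P ≡ x Q - y Q [mod 3 ℕ.* k ]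
      vertical : y P ≡ y Q [mod k ]

  ≈-reflexive : ∀ {P Q} → P ≡ Q → P ≈ Q
  ≈-reflexive P≡Q = mk≈ (mod-≡ (cong (λ P → x P - y P) P≡Q)) (mod-≡ (cong y P≡Q))

  ≈-refl : ∀ {P} → P ≈ P
  ≈-refl = ≈-reflexive refl

  ≈-sym : ∀ {P Q} → P ≈ Q → Q ≈ P
  ≈-sym (mk≈ d v) = mk≈ (mod-sym d) (mod-sym v)

  ≈-trans : ∀ {P Q R} → P ≈ Q → Q ≈ R → P ≈ R
  ≈-trans (mk≈ d v) (mk≈ d′ v′) = mk≈ (mod-trans d d′) (mod-trans v v′)

  ≈-setoid : Setoid _ _
  ≈-setoid = record
    { Carrier = Point ; _≈_ = _≈_
    ; isEquivalence = record { refl = ≈-refl ; sym = ≈-sym ; trans = ≈-trans } }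

  ⊕-cong : ∀ {P P′ Q Q′} → P ≈ P′ → Q ≈ Q′ → P ⊕ Q ≈ P′ ⊕ Q′
  ⊕-cong {P} {P′} {Q} {Q′} (mk≈ d v) (mk≈ d′ v′) =
    mk≈ (mod-resp (lemma (x P) (y P) (x Q) (y Q)) (lemma (x P′) (y P′) (x Q′) (y Q′)) (mod-+ d d′)) (mod-+ v v′)
    where lemma : ∀ x y x′ y′ → (x - y) + (x′ - y′) ≡ (x + x′) - (y + y′)
          lemma = solve-∀

  ⊖-cong : ∀ {P P′ Q Q′} → P ≈ P′ → Q ≈ Q′ → P ⊖ Q ≈ P′ ⊖ Q′
  ⊖-cong {P} {P′} {Q} {Q′} (mk≈ d v) (mk≈ d′ v′) =
    mk≈ (mod-resp (lemma (x P) (y P) (x Q) (y Q)) (lemma (x P′) (y P′) (x Q′) (y Q′)) (mod-- d d′)) (mod-- v v′)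
    where lemma : ∀ x y x′ y′ → (x - y) - (x′ - y′) ≡ (x - x′) - (y - y′)
          lemma = solve-∀

  ⊕-congʳ : ∀ R {P Q} → P ≈ Q → P ⊕ R ≈ Q ⊕ R
  ⊕-congʳ R P≈Q = ⊕-cong P≈Q (≈-refl {R})

  ⊖-congʳ : ∀ R {P Q} → P ≈ Q → P ⊖ R ≈ Q ⊖ R
  ⊖-congʳ R P≈Q = ⊖-cong P≈Q (≈-refl {R})

  ⊖-congˡ : ∀ R {P Q} → P ≈ Q → R ⊖ P ≈ R ⊖ Q
  ⊖-congˡ R P≈Q = ⊖-cong (≈-refl {R}) P≈Q

  Cell : Set
  Cell = Fin (3 ℕ.* k) × Fin k

  cell : Point → Cell
  cell P = reduce (3 ℕ.* k) (x P - y P) , reduce k (y P)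

  point : Cell → Point
  point (p , q) = ⟨ toℤ p + toℤ q , toℤ q ⟩

  cell-cong : ∀ {P Q} → P ≈ Q → cell P ≡ cell Q
  cell-cong (mk≈ d v) = cong₂ _,_ (reduce-cong (3 ℕ.* k) d) (reduce-cong k v)

  cell-injective : ∀ P Q → cell P ≡ cell Q → P ≈ Q
  cell-injective P Q e = mk≈ (reduce-injective (3 ℕ.* k) (cong proj₁ e)) (reduce-injective k (cong proj₂ e))

  private
    cancel : ∀ a b → (a + b) - b ≡ a
    cancel = solve-∀

  cell-point : ∀ a → cell (point a) ≡ a
  cell-point (p , q) =
    cong₂ _,_ (trans (cong (reduce (3 ℕ.* k)) (cancel (toℤ p) (toℤ q))) (reduce-toℤ (3 ℕ.* k) p)) (reduce-toℤ k q)

  point-cell : ∀ P → point (cell P) ≈ P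
  point-cell P = mk≈
    (mod-resp (sym (cancel (toℤ (proj₁ (cell P))) (toℤ (proj₂ (cell P))))) refl (toℤ-reduce (3 ℕ.* k) _))
    (toℤ-reduce k _)

  record Matrix : Set where
    constructor matrix
    field
      m₁₁ m₁₂ m₂₁ m₂₂ : ℤ
  open Matrix

  apply : Matrix → Point → Point
  apply M P = ⟨ m₁₁ M * x P + m₁₂ M * y P , m₂₁ M * x P + m₂₂ M * y P ⟩

  infixl 7 _·_
  _·_ : Matrix → Matrix → Matrix
  M · N = matrix (m₁₁ M * m₁₁ N + m₁₂ M * m₂₁ N) (m₁₁ M * m₁₂ N + m₁₂ M * m₂₂ N)
                 (m₂₁ M * m₁₁ N + m₂₂ M * m₂₁ N) (m₂₁ M * m₁₂ N + m₂₂ M * m₂₂ N)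

  identity : Matrix
  identity = matrix (+ 1) (+ 0) (+ 0) (+ 1)

  apply-· : ∀ M N P → apply (M · N) P ≡ apply M (apply N P)
  apply-· M N P = point-≡ (lemma (m₁₁ M) (m₁₂ M) (m₁₁ N) (m₁₂ N) (m₂₁ N) (m₂₂ N) (x P) (y P))
                          (lemma (m₂₁ M) (m₂₂ M) (m₁₁ N) (m₁₂ N) (m₂₁ N) (m₂₂ N) (x P) (y P))
    where lemma : ∀ m m′ a b c d x y →
                  (m * a + m′ * c) * x + (m * b + m′ * d) * y ≡ m * (a * x + b * y) + m′ * (c * x + d * y)
          lemma = solve-∀

  apply-identity : ∀ P → apply identity P ≡ P
  apply-identity P = point-≡ (lemma (x P) (y P)) (lemma′ (x P) (y P))
    where lemma : ∀ x y → + 1 * x + + 0 * y ≡ x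
          lemma = solve-∀
          lemma′ : ∀ x y → + 0 * x + + 1 * y ≡ y
          lemma′ = solve-∀

  apply-involutive : ∀ M → M · M ≡ identity → ∀ P → apply M (apply M P) ≡ P
  apply-involutive M M²≡I P = trans (sym (apply-· M M P)) (trans (cong (λ N → apply N P) M²≡I) (apply-identity P))

  apply-⊕ : ∀ M P Q → apply M (P ⊕ Q) ≡ apply M P ⊕ apply M Q
  apply-⊕ M P Q = point-≡ (lemma (m₁₁ M) (m₁₂ M) (x P) (y P) (x Q) (y Q))
                          (lemma (m₂₁ M) (m₂₂ M) (x P) (y P) (x Q) (y Q))
    where lemma : ∀ a b x y x′ y′ → a * (x + x′) + b * (y + y′) ≡ (a * x + b * y) + (a * x′ + b * y′)
          lemma = solve-∀

  apply-⊖ : ∀ M P Q → apply M (P ⊖ Q) ≡ apply M P ⊖ apply M Q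
  apply-⊖ M P Q = point-≡ (lemma (m₁₁ M) (m₁₂ M) (x P) (y P) (x Q) (y Q))
                          (lemma (m₂₁ M) (m₂₂ M) (x P) (y P) (x Q) (y Q))
    where lemma : ∀ a b x y x′ y′ → a * (x - x′) + b * (y - y′) ≡ (a * x + b * y) - (a * x′ + b * y′)
          lemma = solve-∀

  apply-signed : ∀ M s P → apply M (signed s P) ≡ signed s (apply M P)
  apply-signed M false P = refl
  apply-signed M true  P = point-≡ (lemma (m₁₁ M) (m₁₂ M) (x P) (y P)) (lemma (m₂₁ M) (m₂₂ M) (x P) (y P))
    where lemma : ∀ a b x y → a * - x + b * - y ≡ - (a * x + b * y)
          lemma = solve-∀

  -- For (x′, y′) = M (x, y): x′ - y′ = (m₁₁ - m₂₁)(x - y) + ((m₁₁ - m₂₁) + (m₁₂ - m₂₂)) y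
  -- and y′ = m₂₁ (x - y) + (m₂₁ + m₂₂) y.
  apply-cong : ∀ M → + 3 ∣ (m₁₁ M - m₂₁ M) + (m₁₂ M - m₂₂ M) → ∀ {P Q} → P ≈ Q → apply M P ≈ apply M Q
  apply-cong M (divides m 3m) {P} {Q} (mk≈ diag vert) = mk≈
    (mod-resp (sym (diagonal-form P)) (sym (diagonal-form Q))
      (mod-+ (mod-*ˡ (m₁₁ M - m₂₁ M) diag) (mod-resp (lemma′ m (y P)) (lemma′ m (y Q)) (mod-scale 3 (mod-*ˡ m vert)))))
    (mod-resp (sym (vertical-form P)) (sym (vertical-form Q))
      (mod-+ (mod-*ˡ (m₂₁ M) (mod-∣ (ℕ.n∣m*n 3) diag)) (mod-*ˡ (m₂₁ M + m₂₂ M) vert)))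
    where
    lemma : ∀ a b c d x y → (a * x + b * y) - (c * x + d * y) ≡ (a - c) * (x - y) + ((a - c) + (b - d)) * y
    lemma = solve-∀
    lemma′ : ∀ m y → + 3 * (m * y) ≡ m * + 3 * y
    lemma′ = solve-∀
    diagonal-form : ∀ P → x (apply M P) - y (apply M P) ≡ (m₁₁ M - m₂₁ M) * (x P - y P) + m * + 3 * y P
    diagonal-form P = trans (lemma (m₁₁ M) (m₁₂ M) (m₂₁ M) (m₂₂ M) (x P) (y P))
                            (cong (λ z → (m₁₁ M - m₂₁ M) * (x P - y P) + z * y P) 3m)
    vertical-form : ∀ P → y (apply M P) ≡ m₂₁ M * (x P - y P) + (m₂₁ M + m₂₂ M) * y P
    vertical-form P = lemma″ (m₂₁ M) (m₂₂ M) (x P) (y P)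
      where lemma″ : ∀ c d x y → c * x + d * y ≡ c * (x - y) + (c + d) * y
            lemma″ = solve-∀

  pattern black = false
  pattern white = true

  Vertex : Set
  Vertex = Bool × Cell

  direction : Fin 3 → Point
  direction 0F = origin
  direction 1F = ⟨ + 1 , + 0 ⟩
  direction 2F = ⟨ + 0 , + 1 ⟩

  private
    <3k : ∀ {i} → i ℕ.< 3 → i ℕ.< 3 ℕ.* k
    <3k i<3 = ℕ.<-≤-trans i<3 (ℕ.*-monoʳ-≤ 3 (ℕ.>-nonZero⁻¹ k))

  -- The diagonal coordinates 0, 1, -1 of the directions are distinct modulo 3k ≥ 3.
  direction-injective : ∀ {s t} → direction s ≈ direction t → s ≡ t
  direction-injective {0F} {0F} _ = refl
  direction-injective {1F} {1F} _ = refl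
  direction-injective {2F} {2F} _ = refl
  direction-injective {0F} {1F} (mk≈ diag _)
    with () ← remainder-unique {r = 0} {s = 1} (<3k ℕ.z<s) (<3k (ℕ.s<s ℕ.z<s)) diag
  direction-injective {0F} {2F} (mk≈ diag _)
    with () ← remainder-unique {r = 1} {s = 0} (<3k (ℕ.s<s ℕ.z<s)) (<3k ℕ.z<s) (mod-+ diag (mod-≡ {b = + 1} refl))
  direction-injective {1F} {2F} (mk≈ diag _)
    with () ← remainder-unique {r = 2} {s = 0} (<3k (ℕ.s<s (ℕ.s<s ℕ.z<s))) (<3k ℕ.z<s) (mod-+ diag (mod-≡ {b = + 1} refl))
  direction-injective {1F} {0F} p = sym (direction-injective (≈-sym p))
  direction-injective {2F} {0F} p = sym (direction-injective (≈-sym p))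
  direction-injective {2F} {1F} p = sym (direction-injective (≈-sym p))

  cell-≈ : ∀ {P} a → P ≈ point a → cell P ≡ a
  cell-≈ a P≈a = trans (cell-cong P≈a) (cell-point a)

  cell-⊖-origin : ∀ a → cell (point a ⊖ origin) ≡ a
  cell-⊖-origin a = cell-≈ a (≈-reflexive (coordinatewise₂ (λ p _ → ℤ.+-identityʳ p) (point a) origin))

  -- A black vertex a is adjacent to the white vertices a - direction s, and a
  -- white vertex a to the black vertices a + direction s.
  neighbour : Fin 3 → Vertex → Vertex
  neighbour s (c , a) = not c , cell (point a ⊖ signed c (direction s))

  neighbour-involutive : ∀ s v → neighbour s (neighbour s v) ≡ v
  neighbour-involutive s (black , a) = cong (black ,_) (cell-≈ a (begin
    point (cell (A ⊖ D)) ⊖ signed white D  ≈⟨ ⊖-congʳ (signed white D) (point-cell (A ⊖ D)) ⟩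
    A ⊖ D ⊖ signed white D                 ≡⟨ coordinatewise₂ lemma A D ⟩
    A                                      ∎))
    where
    open SetoidReasoning ≈-setoid
    A = point a
    D = direction s
    lemma : ∀ a s → (a - s) - - s ≡ a
    lemma = solve-∀
  neighbour-involutive s (white , a) = cong (white ,_) (cell-≈ a (begin
    point (cell (A ⊖ signed white D)) ⊖ D  ≈⟨ ⊖-congʳ D (point-cell (A ⊖ signed white D)) ⟩
    A ⊖ signed white D ⊖ D                 ≡⟨ coordinatewise₂ lemma A D ⟩
    A                                      ∎))
    where
    open SetoidReasoning ≈-setoid
    A = point a
    D = direction s
    lemma : ∀ a s → (a - - s) - s ≡ a
    lemma = solve-∀

  neighbour-irreflexive : ∀ s v → neighbour s v ≢ v
  neighbour-irreflexive s (black , a) ()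
  neighbour-irreflexive s (white , a) ()

  neighbour-injective : ∀ v {s t} → neighbour s v ≡ neighbour t v → s ≡ t
  neighbour-injective (black , a) {s} {t} e = direction-injective (begin
    direction s                    ≡⟨ coordinatewise₂ lemma A (direction s) ⟨
    A ⊖ (A ⊖ direction s)          ≈⟨ ⊖-congˡ A (cell-injective (A ⊖ direction s) (A ⊖ direction t) (cong proj₂ e)) ⟩
    A ⊖ (A ⊖ direction t)          ≡⟨ coordinatewise₂ lemma A (direction t) ⟩
    direction t                    ∎)
    where
    open SetoidReasoning ≈-setoid
    A = point a
    lemma : ∀ a s → a - (a - s) ≡ s
    lemma = solve-∀
  neighbour-injective (white , a) {s} {t} e = direction-injective (begin
    direction s                    ≡⟨ coordinatewise₂ lemma A (direction s) ⟨
    A ⊖ signed white (direction s) ⊖ A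
      ≈⟨ ⊖-congʳ A (cell-injective (A ⊖ signed white (direction s)) (A ⊖ signed white (direction t)) (cong proj₂ e)) ⟩
    A ⊖ signed white (direction t) ⊖ A
      ≡⟨ coordinatewise₂ lemma A (direction t) ⟩
    direction t                    ∎)
    where
    open SetoidReasoning ≈-setoid
    A = point a
    lemma : ∀ a s → (a - - s) - a ≡ s
    lemma = solve-∀

  signed-xor : ∀ b c P → signed (b xor c) P ≡ signed b (signed c P)
  signed-xor false c     P = refl
  signed-xor true  false P = refl
  signed-xor true  true  P = sym (point-≡ (ℤ.neg-involutive (x P)) (ℤ.neg-involutive (y P)))

  apply-origin : ∀ M → apply M origin ≡ origin
  apply-origin M = point-≡ (lemma (m₁₁ M) (m₁₂ M)) (lemma (m₂₁ M) (m₂₂ M))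
    where lemma : ∀ a b → a * + 0 + b * + 0 ≡ + 0
          lemma = solve-∀

  xor-cancelʳ : ∀ b c → (b xor c) xor c ≡ b
  xor-cancelʳ b c = trans (xor-assoc b c c) (trans (cong (b xor_) (xor-same c)) (xor-identityʳ b))

  -- The linear part M of an automorphism.  With a translation t it sends the black
  -- cell a to M a + t and the white cell a to M a + t + offset, swapping the colours
  -- if `swaps`; `compatible` says that the edge along direction s is sent to the edge
  -- along direction (relabel s).
  record Symmetry : Set where
    field
      swaps             : Bool
      linear            : Matrix
      preserves-lattice : + 3 ∣ (m₁₁ linear - m₂₁ linear) + (m₁₂ linear - m₂₂ linear)
      involutive        : linear · linear ≡ identity
      offset            : Point
      relabel           : Permutation′ 3
      compatible        : ∀ s → apply linear (direction s) ≡ offset ⊕ signed swaps (direction (relabel ⟨$⟩ʳ s))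

  module _ (S : Symmetry) (t : Point) where
    open Symmetry S

    private
      M = linear

      M-cong : ∀ {P Q} → P ≈ Q → apply M P ≈ apply M Q
      M-cong = apply-cong M preserves-lattice

      M-involutive : ∀ P → apply M (apply M P) ≡ P
      M-involutive = apply-involutive M involutive

      shift : Bool → Point
      shift black = t
      shift white = t ⊕ offset

      move unmove : Bool → Cell → Cell
      move   c a = cell (apply M (point a) ⊕ shift c)
      unmove c b = cell (apply M (point b ⊖ shift c))

      unmove-move : ∀ c a → unmove c (move c a) ≡ a
      unmove-move c a = cell-≈ a (begin
        apply M (point (move c a) ⊖ shift c)   ≈⟨ M-cong (⊖-congʳ (shift c) (point-cell (apply M (point a) ⊕ shift c))) ⟩
        apply M (apply M (point a) ⊕ shift c ⊖ shift c)
                                               ≡⟨ cong (apply M) (coordinatewise₂ lemma (apply M (point a)) (shift c)) ⟩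
        apply M (apply M (point a))            ≡⟨ M-involutive (point a) ⟩
        point a                                ∎)
        where
        open SetoidReasoning ≈-setoid
        lemma : ∀ p t → (p + t) - t ≡ p
        lemma = solve-∀

      move-unmove : ∀ c b → move c (unmove c b) ≡ b
      move-unmove c b = cell-≈ b (begin
        apply M (point (unmove c b)) ⊕ shift c           ≈⟨ ⊕-congʳ (shift c) (M-cong (point-cell (apply M (point b ⊖ shift c)))) ⟩
        apply M (apply M (point b ⊖ shift c)) ⊕ shift c  ≡⟨ cong (_⊕ shift c) (M-involutive (point b ⊖ shift c)) ⟩
        point b ⊖ shift c ⊕ shift c                      ≡⟨ coordinatewise₂ lemma (point b) (shift c) ⟩
        point b                                          ∎)
        where
        open SetoidReasoning ≈-setoid
        lemma : ∀ p t → (p - t) + t ≡ p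
        lemma = solve-∀

    act : Vertex ↔ Vertex
    act = mk↔ₛ′ (λ (c , a) → c xor swaps , move c a)
                (λ (c , b) → c xor swaps , unmove (c xor swaps) b)
      (λ (c , b) → cong₂ _,_ (xor-cancelʳ c swaps) (move-unmove (c xor swaps) b))
      (λ (c , a) → unmove∘move c a)
      where
      unmove∘move : ∀ c a → ((c xor swaps) xor swaps , unmove ((c xor swaps) xor swaps) (move c a)) ≡ (c , a)
      unmove∘move c a rewrite xor-cancelʳ c swaps = cong (c ,_) (unmove-move c a)

    open Inverse act using (to)

    act-neighbour : ∀ s v → to (neighbour s v) ≡ neighbour (relabel ⟨$⟩ʳ s) (to v)
    act-neighbour s (c , a) = cong₂ _,_ (sym (not-distribˡ-xor c swaps)) (cell-cong (begin
      apply M (point (cell (point a ⊖ signed c D))) ⊕ shift (not c)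
        ≈⟨ ⊕-congʳ (shift (not c)) (M-cong (point-cell (point a ⊖ signed c D))) ⟩
      apply M (point a ⊖ signed c D) ⊕ shift (not c)
        ≡⟨ cong (_⊕ shift (not c)) (trans (apply-⊖ M (point a) (signed c D)) (cong (A ⊖_) (apply-signed M c D))) ⟩
      A ⊖ signed c (apply M D) ⊕ shift (not c)
        ≡⟨ cong (λ P → A ⊖ signed c P ⊕ shift (not c)) (compatible s) ⟩
      A ⊖ signed c (offset ⊕ signed swaps W) ⊕ shift (not c)
        ≡⟨ rearrange c (signed swaps W) ⟩
      A ⊕ shift c ⊖ signed c (signed swaps W)
        ≡⟨ cong (A ⊕ shift c ⊖_) (signed-xor c swaps W) ⟨
      A ⊕ shift c ⊖ signed (c xor swaps) W
        ≈⟨ ⊖-congʳ (signed (c xor swaps) W) (≈-sym (point-cell (A ⊕ shift c))) ⟩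
      point (move c a) ⊖ signed (c xor swaps) W ∎))
      where
      open SetoidReasoning ≈-setoid
      D = direction s
      W = direction (relabel ⟨$⟩ʳ s)
      A = apply M (point a)
      rearrange : ∀ c Q → A ⊖ signed c (offset ⊕ Q) ⊕ shift (not c) ≡ A ⊕ shift c ⊖ signed c Q
      rearrange black Q = coordinatewise₄ lemma A offset Q t
        where lemma : ∀ a o q t → a - (o + q) + (t + o) ≡ a + t - q
              lemma = solve-∀
      rearrange white Q = coordinatewise₄ lemma A offset Q t
        where lemma : ∀ a o q t → a - - (o + q) + t ≡ a + (t + o) - - q
              lemma = solve-∀

  flag : Bool → Fin 3 → Symmetry
  flag black 0F = record
    { swaps = black ; linear = identity ; preserves-lattice = divides (+ 0) refl ; involutive = refl
    ; offset = origin ; relabel = Perm.id ; compatible = λ { 0F → refl ; 1F → refl ; 2F → refl } }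
  flag black 1F = record
    { swaps = black ; linear = matrix -1ℤ -1ℤ (+ 0) (+ 1) ; preserves-lattice = divides -1ℤ refl ; involutive = refl
    ; offset = ⟨ -1ℤ , + 0 ⟩ ; relabel = transpose 0F 1F ; compatible = λ { 0F → refl ; 1F → refl ; 2F → refl } }
  flag black 2F = record
    { swaps = black ; linear = matrix (+ 1) (+ 0) -1ℤ -1ℤ ; preserves-lattice = divides (+ 1) refl ; involutive = refl
    ; offset = ⟨ + 0 , -1ℤ ⟩ ; relabel = transpose 0F 2F ; compatible = λ { 0F → refl ; 1F → refl ; 2F → refl } }
  flag white 0F = record
    { swaps = white ; linear = matrix -1ℤ (+ 0) (+ 0) -1ℤ ; preserves-lattice = divides (+ 0) refl ; involutive = refl
    ; offset = origin ; relabel = Perm.id ; compatible = λ { 0F → refl ; 1F → refl ; 2F → refl } }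
  flag white 1F = record
    { swaps = white ; linear = matrix (+ 1) (+ 1) (+ 0) -1ℤ ; preserves-lattice = divides (+ 1) refl ; involutive = refl
    ; offset = direction 1F ; relabel = transpose 0F 1F ; compatible = λ { 0F → refl ; 1F → refl ; 2F → refl } }
  flag white 2F = record
    { swaps = white ; linear = matrix -1ℤ (+ 0) (+ 1) (+ 1) ; preserves-lattice = divides -1ℤ refl ; involutive = refl
    ; offset = direction 2F ; relabel = transpose 0F 2F ; compatible = λ { 0F → refl ; 1F → refl ; 2F → refl } }

  flag-swaps : ∀ c s → Symmetry.swaps (flag c s) ≡ c
  flag-swaps black 0F = refl
  flag-swaps black 1F = refl
  flag-swaps black 2F = refl
  flag-swaps white 0F = refl
  flag-swaps white 1F = refl
  flag-swaps white 2F = refl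

  flag-relabel : ∀ c s → Symmetry.relabel (flag c s) ⟨$⟩ʳ 0F ≡ s
  flag-relabel black 0F = refl
  flag-relabel black 1F = refl
  flag-relabel black 2F = refl
  flag-relabel white 0F = refl
  flag-relabel white 1F = refl
  flag-relabel white 2F = refl

  opaque
    enumeration : Fin (6 ℕ.* k ℕ.^ 2) ↔ Vertex
    enumeration = (Fin.2↔Bool ×-↔ Fin.*↔×) ↔-∘ (Fin.*↔× ↔-∘ Perm.cast-id (size k))
      where
      regroup : ∀ k → 6 ℕ.* (k ℕ.* k) ≡ 2 ℕ.* (3 ℕ.* k ℕ.* k)
      regroup = ℕ-solve-∀
      size : ∀ k → 6 ℕ.* k ℕ.^ 2 ≡ 2 ℕ.* (3 ℕ.* k ℕ.* k)
      size k = trans (cong (λ m → 6 ℕ.* (k ℕ.* m)) (ℕ.*-identityʳ k)) (regroup k)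

  open MatchingGraph enumeration neighbour neighbour-involutive neighbour-irreflexive neighbour-injective public

  act-isAutomorphism : ∀ S t → IsAutomorphism graph (lift (act S t))
  act-isAutomorphism S t = lift-isAutomorphism (act S t) (Symmetry.relabel S) (act-neighbour S t)

  base : Vertex
  base = black , cell origin

  act-base : ∀ S t → Inverse.to (act S t) base ≡ (Symmetry.swaps S , cell t)
  act-base S t = cong (Symmetry.swaps S ,_) (cell-cong (begin
    apply linear (point (cell origin)) ⊕ t
      ≈⟨ ⊕-congʳ t (apply-cong linear preserves-lattice (point-cell origin)) ⟩
    apply linear origin ⊕ t               ≡⟨ cong (_⊕ t) (apply-origin linear) ⟩
    origin ⊕ t                            ≡⟨ coordinatewise₂ (λ _ t → ℤ.+-identityˡ t) origin t ⟩
    t                                     ∎))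
    where
    open Symmetry S
    open SetoidReasoning ≈-setoid

  act-flag : ∀ v s → Inverse.to (act (flag (proj₁ v) s) (point (proj₂ v))) base ≡ v
  act-flag (c , a) s = trans (act-base (flag c s) (point a)) (cong₂ _,_ (flag-swaps c s) (cell-point a))

  -- flag c s, translated to a c-coloured vertex v, carries the arc from base to its
  -- 0-th neighbour onto the arc from v to its s-th neighbour.
  flag-onto : ∀ i j s → vertex j ≡ neighbour s (vertex i) →
    Σ (Permutation′ (6 ℕ.* k ℕ.^ 2)) λ σ →
      IsAutomorphism graph σ × σ ⟨$⟩ʳ index base ≡ i × σ ⟨$⟩ʳ index (neighbour 0F base) ≡ j
  flag-onto i j s j≡ = lift σ , act-isAutomorphism S t , (begin
      lift σ ⟨$⟩ʳ index base  ≡⟨ lift-index σ base ⟩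
      index (to base)         ≡⟨ cong index (act-flag (vertex i) s) ⟩
      index (vertex i)        ≡⟨ index-vertex i ⟩
      i                       ∎) , (begin
      lift σ ⟨$⟩ʳ index (neighbour 0F base)
        ≡⟨ lift-index σ (neighbour 0F base) ⟩
      index (to (neighbour 0F base))
        ≡⟨ cong index (act-neighbour S t 0F base) ⟩
      index (neighbour (Symmetry.relabel S ⟨$⟩ʳ 0F) (to base))
        ≡⟨ cong index (cong₂ neighbour (flag-relabel (proj₁ (vertex i)) s) (act-flag (vertex i) s)) ⟩
      index (neighbour s (vertex i))  ≡⟨ cong index j≡ ⟨
      index (vertex j)                ≡⟨ index-vertex j ⟩
      j                               ∎)
    where
    open ≡-Reasoning
    S : Symmetry
    S = flag (proj₁ (vertex i)) s
    t : Point
    t = point (proj₂ (vertex i))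
    σ : Vertex ↔ Vertex
    σ = act S t
    open Inverse σ using (to)

  honeycomb-arcTransitive : ArcTransitive graph
  honeycomb-arcTransitive = arcTransitive-from graph (index base) (index (neighbour 0F base))
    λ i j i~j → let s , j≡ = adj⇒match {i} {j} i~j in flag-onto i j s j≡

  walk-neighbour : ∀ s v → Walk graph (index v) (index (neighbour s v))
  walk-neighbour s v = step (adj-match s v) here

  -- Through the white vertex below it, a black vertex reaches its translate by any direction.
  walk-advance : ∀ s P Q → P ⊕ direction s ≈ Q → Walk graph (index (black , cell P)) (index (black , cell Q))
  walk-advance s P Q P+s≈Q = walk-neighbour 0F (black , cell P) ++ʷ
    subst (Walk graph _) (cong index lands) (walk-neighbour s (neighbour 0F (black , cell P)))
    where
    open SetoidReasoning ≈-setoid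
    lemma : ∀ p s → (p - + 0) - - s ≡ p + s
    lemma = solve-∀
    lands : neighbour s (neighbour 0F (black , cell P)) ≡ (black , cell Q)
    lands = cong (black ,_) (cell-cong (begin
      point (cell (point (cell P) ⊖ origin)) ⊖ signed white (direction s)
        ≈⟨ ⊖-congʳ (signed white (direction s)) (point-cell (point (cell P) ⊖ origin)) ⟩
      point (cell P) ⊖ origin ⊖ signed white (direction s)
        ≈⟨ ⊖-congʳ (signed white (direction s)) (⊖-congʳ origin (point-cell P)) ⟩
      P ⊖ origin ⊖ signed white (direction s)  ≡⟨ coordinatewise₂ lemma P (direction s) ⟩
      P ⊕ direction s                          ≈⟨ P+s≈Q ⟩
      Q                                        ∎))

  walk-base : ∀ m n → Walk graph (index base) (index (black , cell ⟨ + m , + n ⟩))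
  walk-base zero    zero    = here
  walk-base (suc m) n       = walk-base m n ++ʷ walk-advance 1F ⟨ + m , + n ⟩ ⟨ + suc m , + n ⟩
    (≈-reflexive (point-≡ (cong +_ (ℕ.+-comm m 1)) (cong +_ (ℕ.+-identityʳ n))))
  walk-base zero    (suc n) = walk-base zero n ++ʷ walk-advance 2F ⟨ + 0 , + n ⟩ ⟨ + 0 , + suc n ⟩
    (≈-reflexive (point-≡ refl (cong +_ (ℕ.+-comm n 1))))

  walk-everywhere : ∀ v → Walk graph (index base) (index v)
  walk-everywhere (black , a@(p , q)) =
    subst (λ a → Walk graph (index base) (index (black , a))) (cell-point a) (walk-base (toℕ p ℕ.+ toℕ q) (toℕ q))
  walk-everywhere (white , a) =
    subst (λ a → Walk graph (index base) (index (white , a))) (cell-⊖-origin a)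
      (walk-everywhere (black , a) ++ʷ walk-neighbour 0F (black , a))

  honeycomb-connected : Connected graph
  honeycomb-connected = connected-from graph (index base)
    λ i → subst (Walk graph (index base)) (index-vertex i) (walk-everywhere (vertex i))

  translate : Point → Vertex → Vertex
  translate P (c , a) = c , cell (point a ⊕ P)

  translate-origin : ∀ v → translate origin v ≡ v
  translate-origin (c , a) = cong (c ,_) (cell-≈ a (≈-reflexive (coordinatewise₂ (λ p _ → ℤ.+-identityʳ p) (point a) origin)))

  translate-translate : ∀ P Q v → translate Q (translate P v) ≡ translate (P ⊕ Q) v
  translate-translate P Q (c , a) = cong (c ,_) (cell-cong (begin
    point (cell (point a ⊕ P)) ⊕ Q  ≈⟨ ⊕-congʳ Q (point-cell (point a ⊕ P)) ⟩
    point a ⊕ P ⊕ Q                 ≡⟨ coordinatewise₃ ℤ.+-assoc (point a) P Q ⟩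
    point a ⊕ (P ⊕ Q)               ∎))
    where open SetoidReasoning ≈-setoid

  -- If a translation fixes one vertex, its vector lies in the lattice.
  translate-fixed : ∀ P {v} w → translate P v ≡ v → translate P w ≡ w
  translate-fixed P {c , a} (c′ , b) fixed = cong (c′ ,_) (cell-≈ b (begin
    point b ⊕ P                       ≡⟨ coordinatewise₃ lemma (point b) P (point a) ⟩
    point b ⊕ (point a ⊕ P ⊖ point a) ≈⟨ ⊕-cong (≈-refl {point b}) (⊖-congʳ (point a) P-fixes-a) ⟩
    point b ⊕ (point a ⊖ point a)     ≡⟨ coordinatewise₂ lemma′ (point b) (point a) ⟩
    point b                           ∎))
    where
    open SetoidReasoning ≈-setoid
    P-fixes-a : point a ⊕ P ≈ point a
    P-fixes-a = cell-injective (point a ⊕ P) (point a) (trans (cong proj₂ fixed) (sym (cell-point a)))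
    lemma : ∀ b p a → b + p ≡ b + ((a + p) - a)
    lemma = solve-∀
    lemma′ : ∀ b a → b + (a - a) ≡ b
    lemma′ = solve-∀

  glide : Symmetry
  glide = record
    { swaps = white ; linear = matrix (+ 0) -1ℤ -1ℤ (+ 0) ; preserves-lattice = divides (+ 0) refl ; involutive = refl
    ; offset = origin ; relabel = transpose 1F 2F ; compatible = λ { 0F → refl ; 1F → refl ; 2F → refl } }

  slide : ℕ → Point
  slide j = ⟨ + j , - + j ⟩

  private
    glide-square-cell : ∀ a t t′ → let M = Symmetry.linear glide in apply M t ⊕ t′ ≡ slide 1 →
      cell (apply M (point (cell (apply M (point a) ⊕ t))) ⊕ t′) ≡ cell (point a ⊕ slide 1)
    glide-square-cell a t t′ Mt+t′≡slide = cell-cong (begin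
      apply M (point (cell (apply M (point a) ⊕ t))) ⊕ t′
        ≈⟨ ⊕-congʳ t′ (apply-cong M (divides (+ 0) refl) (point-cell (apply M (point a) ⊕ t))) ⟩
      apply M (apply M (point a) ⊕ t) ⊕ t′
        ≡⟨ cong (_⊕ t′) (trans (apply-⊕ M (apply M (point a)) t) (cong (_⊕ apply M t) (apply-involutive M refl (point a)))) ⟩
      point a ⊕ apply M t ⊕ t′    ≡⟨ coordinatewise₃ ℤ.+-assoc (point a) (apply M t) t′ ⟩
      point a ⊕ (apply M t ⊕ t′)  ≡⟨ cong (point a ⊕_) Mt+t′≡slide ⟩
      point a ⊕ slide 1           ∎)
      where
      open SetoidReasoning ≈-setoid
      M = Symmetry.linear glide

  glide-map : Vertex ↔ Vertex
  glide-map = act glide (direction 1F)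

  open Inverse glide-map using () renaming (to to glide-to; from to glide-from; strictlyInverseˡ to glide-to-from)

  glide-square : ∀ v → glide-to (glide-to v) ≡ translate (slide 1) v
  glide-square (black , a) = cong (black ,_) (glide-square-cell a (direction 1F) (direction 1F ⊕ origin) refl)
  glide-square (white , a) = cong (white ,_) (glide-square-cell a (direction 1F ⊕ origin) (direction 1F) refl)

  glide-recolours : ∀ v → proj₁ (glide-to v) ≡ not (proj₁ v)
  glide-recolours (c , a) = xor-comm c true

  slide-suc : ∀ j → slide j ⊕ slide 1 ≡ slide (suc j)
  slide-suc j = point-≡ (cong +_ (ℕ.+-comm j 1)) (trans (sym (ℤ.neg-distrib-+ (+ j) (+ 1))) (cong (λ m → - + m) (ℕ.+-comm j 1)))

  translate-slide : ∀ j v → translate (slide 1) (translate (slide j) v) ≡ translate (slide (suc j)) v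
  translate-slide j v = trans (translate-translate (slide j) (slide 1) v) (cong (λ P → translate P v) (slide-suc j))

  opaque
    ρ : Permutation′ (6 ℕ.* k ℕ.^ 2)
    ρ = lift glide-map

    ρ-index : ∀ v → ρ ⟨$⟩ʳ index v ≡ index (glide-to v)
    ρ-index v = lift-index glide-map v

    ρ-isAutomorphism : IsAutomorphism graph ρ
    ρ-isAutomorphism = act-isAutomorphism glide (direction 1F)

  ρ²-index : ∀ v → ρ ⟨$⟩ʳ (ρ ⟨$⟩ʳ index v) ≡ index (translate (slide 1) v)
  ρ²-index v = trans (cong (ρ ⟨$⟩ʳ_) (ρ-index v)) (trans (ρ-index (glide-to v)) (cong index (glide-square v)))

  pow-ρ-even : ∀ j i → pow ρ (j ℕ.* 2) i ≡ index (translate (slide j) (vertex i))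
  pow-ρ-even zero    i = sym (trans (cong index (translate-origin (vertex i))) (index-vertex i))
  pow-ρ-even (suc j) i = begin
    ρ ⟨$⟩ʳ (ρ ⟨$⟩ʳ pow ρ (j ℕ.* 2) i)                     ≡⟨ cong (λ m → ρ ⟨$⟩ʳ (ρ ⟨$⟩ʳ m)) (pow-ρ-even j i) ⟩
    ρ ⟨$⟩ʳ (ρ ⟨$⟩ʳ index (translate (slide j) (vertex i)))  ≡⟨ ρ²-index (translate (slide j) (vertex i)) ⟩
    index (translate (slide 1) (translate (slide j) (vertex i)))
                                                          ≡⟨ cong index (translate-slide j (vertex i)) ⟩
    index (translate (slide (suc j)) (vertex i))          ∎
    where open ≡-Reasoning

  pow-ρ-odd : ∀ j i → pow ρ (suc (j ℕ.* 2)) i ≡ index (glide-to (translate (slide j) (vertex i)))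
  pow-ρ-odd j i = trans (cong (ρ ⟨$⟩ʳ_) (pow-ρ-even j i)) (ρ-index _)

  vertex-pow-ρ-odd : ∀ j i → vertex (pow ρ (suc (j ℕ.* 2)) i) ≡ glide-to (translate (slide j) (vertex i))
  vertex-pow-ρ-odd j i = trans (cong vertex (pow-ρ-odd j i)) (vertex-index _)

  vertex-pow-ρ-even : ∀ j i → vertex (pow ρ (j ℕ.* 2) i) ≡ translate (slide j) (vertex i)
  vertex-pow-ρ-even j i = trans (cong vertex (pow-ρ-even j i)) (vertex-index _)

  ρ-semiregular : CyclicSemiregular ρ
  ρ-semiregular i = semiregular (parity i)
    where
    semiregular : ∀ {i} → Parity i → ∀ u → pow ρ i u ≡ u → ∀ w → pow ρ i w ≡ w
    semiregular (even j) u fixed w = begin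
      pow ρ (j ℕ.* 2) w                         ≡⟨ pow-ρ-even j w ⟩
      index (translate (slide j) (vertex w))    ≡⟨ cong index (translate-fixed (slide j) (vertex w) u-fixed) ⟩
      index (vertex w)                          ≡⟨ index-vertex w ⟩
      w                                         ∎
      where
      open ≡-Reasoning
      u-fixed : translate (slide j) (vertex u) ≡ vertex u
      u-fixed = trans (sym (vertex-pow-ρ-even j u)) (cong vertex fixed)
    semiregular (odd j) u fixed w = contradiction (begin
      proj₁ (vertex u)                                              ≡⟨ cong (proj₁ ∘ vertex) fixed ⟨
      proj₁ (vertex (pow ρ (suc (j ℕ.* 2)) u))                      ≡⟨ cong proj₁ (vertex-pow-ρ-odd j u) ⟩
      proj₁ (glide-to (translate (slide j) (vertex u)))             ≡⟨ glide-recolours (translate (slide j) (vertex u)) ⟩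
      not (proj₁ (vertex u))                                        ∎) (not-¬ refl)
      where open ≡-Reasoning

  -- The integer q with toℤ r = x + y + q k determines the number of slides, j ≡ x + 2 q k (mod 3k).
  slide-cover : ∀ P → ∃[ j ] ∃[ r ] ⟨ + 0 , toℤ r ⟩ ⊕ slide j ≈ P
  slide-cover P = toℕ j , r , mk≈ diagonal vertical
    where
    X = Point.x P
    Y = Point.y P
    r = reduce k (X + Y)
    q = proj₁ (mod⇒≡ (toℤ-reduce k (X + Y)))
    r≡ : toℤ r ≡ (X + Y) + q * + k
    r≡ = proj₂ (mod⇒≡ (toℤ-reduce k (X + Y)))
    j₀ = X + q * + k * + 2
    j = reduce (3 ℕ.* k) j₀
    j≡ : toℤ j ≡ j₀ [mod 3 ℕ.* k ]
    j≡ = toℤ-reduce (3 ℕ.* k) j₀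
    diagonal : (+ 0 + toℤ j) - (toℤ r + - toℤ j) ≡ X - Y [mod 3 ℕ.* k ]
    diagonal = mod-trans
      (mod-resp (lemma (toℤ j) (toℤ r)) refl (mod-- (mod-+ j≡ j≡) (mod-≡ {b = toℤ r} refl)))
      (≡⇒mod q (trans (cong (λ r → (j₀ + j₀) - r) r≡)
                      (trans (lemma′ X Y q (+ k)) (cong (λ m → X - Y + q * m) (sym (ℤ.pos-* 3 k))))))
      where
      lemma : ∀ j r → (j + j) - r ≡ (+ 0 + j) - (r + - j)
      lemma = solve-∀
      lemma′ : ∀ x y q k → ((x + q * k * + 2) + (x + q * k * + 2)) - ((x + y) + q * k) ≡ x - y + q * (+ 3 * k)
      lemma′ = solve-∀
    vertical : toℤ r + - toℤ j ≡ Y [mod k ]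
    vertical = mod-trans (mod-- (mod-≡ {b = toℤ r} refl) (mod-∣ (ℕ.n∣m*n 3) j≡))
      (≡⇒mod (- q) (trans (cong (λ r → r - j₀) r≡) (lemma X Y q (+ k))))
      where
      lemma : ∀ x y q k → ((x + y) + q * k) - (x + q * k * + 2) ≡ y + - q * k
      lemma = solve-∀

  representative : Fin k → Fin (6 ℕ.* k ℕ.^ 2)
  representative r = index (black , cell ⟨ + 0 , toℤ r ⟩)

  vertex-representative : ∀ r → vertex (representative r) ≡ (black , cell ⟨ + 0 , toℤ r ⟩)
  vertex-representative r = vertex-index _

  vertex-pow-ρ-representative : ∀ j r →
    vertex (pow ρ (j ℕ.* 2) (representative r)) ≡ (black , cell (point (cell ⟨ + 0 , toℤ r ⟩) ⊕ slide j))
  vertex-pow-ρ-representative j r =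
    trans (vertex-pow-ρ-even j (representative r)) (cong (translate (slide j)) (vertex-representative r))

  orbit-black : ∀ a → ∃[ i ] ∃[ r ] pow ρ i (representative r) ≡ index (black , a)
  orbit-black a = let j , r , slid = slide-cover (point a) in j ℕ.* 2 , r , (begin
    pow ρ (j ℕ.* 2) (representative r)                         ≡⟨ index-vertex _ ⟨
    index (vertex (pow ρ (j ℕ.* 2) (representative r)))        ≡⟨ cong index (vertex-pow-ρ-representative j r) ⟩
    index (black , cell (point (cell ⟨ + 0 , toℤ r ⟩) ⊕ slide j))
      ≡⟨ cong (index ∘ (black ,_)) (cell-≈ a (≈-trans (⊕-congʳ (slide j) (point-cell ⟨ + 0 , toℤ r ⟩)) slid)) ⟩
    index (black , a)                                          ∎)
    where open ≡-Reasoning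

  orbit : ∀ v → ∃[ i ] ∃[ r ] pow ρ i (representative r) ≡ index v
  orbit (black , a) = orbit-black a
  orbit (white , a) = let i , r , reached = orbit-black (proj₂ (glide-from (white , a))) in
    suc i , r , trans (cong (ρ ⟨$⟩ʳ_) reached) (trans (ρ-index _) (cong index (glide-to-from (white , a))))

  -- Twice the vertical congruence plus the diagonal one eliminates the number of slides.
  slide-offset-unique : ∀ j (r r′ : Fin k) → ⟨ + 0 , toℤ r ⟩ ⊕ slide j ≈ ⟨ + 0 , toℤ r′ ⟩ → r ≡ r′
  slide-offset-unique j r r′ (mk≈ diag vert) = Fin.toℕ-injective (remainder-unique (Fin.toℕ<n r) (Fin.toℕ<n r′)
    (mod-resp (lemma (+ j) (toℤ r)) (lemma′ (toℤ r′))
      (mod-+ (mod-∣ (ℕ.n∣m*n 3) diag) (mod-*ˡ (+ 2) vert))))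
    where
    lemma : ∀ j r → ((+ 0 + j) - (r + - j)) + + 2 * (r + - j) ≡ r
    lemma = solve-∀
    lemma′ : ∀ r → (+ 0 - r) + + 2 * r ≡ r
    lemma′ = solve-∀

  representatives-distinct : ∀ i r r′ → pow ρ i (representative r) ≡ representative r′ → r ≡ r′
  representatives-distinct i = distinct (parity i)
    where
    distinct : ∀ {i} → Parity i → ∀ r r′ → pow ρ i (representative r) ≡ representative r′ → r ≡ r′
    distinct (even j) r r′ reached = slide-offset-unique j r r′ (≈-trans
      (≈-sym (⊕-congʳ (slide j) (point-cell ⟨ + 0 , toℤ r ⟩)))
      (cell-injective (point (cell ⟨ + 0 , toℤ r ⟩) ⊕ slide j) ⟨ + 0 , toℤ r′ ⟩ (cong proj₂ (begin
        (black , cell (point (cell ⟨ + 0 , toℤ r ⟩) ⊕ slide j))  ≡⟨ vertex-pow-ρ-representative j r ⟨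
        vertex (pow ρ (j ℕ.* 2) (representative r))             ≡⟨ cong vertex reached ⟩
        vertex (representative r′)                               ≡⟨ vertex-representative r′ ⟩
        (black , cell ⟨ + 0 , toℤ r′ ⟩)                          ∎))))
      where open ≡-Reasoning
    distinct (odd j) r r′ reached = contradiction (begin
      white                                                                  ≡⟨ cong (λ v → not (proj₁ v)) (vertex-representative r) ⟨
      not (proj₁ (vertex (representative r)))                                ≡⟨ glide-recolours (translate (slide j) (vertex (representative r))) ⟨
      proj₁ (glide-to (translate (slide j) (vertex (representative r))))    ≡⟨ cong proj₁ (vertex-pow-ρ-odd j (representative r)) ⟨
      proj₁ (vertex (pow ρ (suc (j ℕ.* 2)) (representative r)))             ≡⟨ cong (proj₁ ∘ vertex) reached ⟩
      proj₁ (vertex (representative r′))                                    ≡⟨ cong proj₁ (vertex-representative r′) ⟩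
      black                                                                  ∎) λ ()
      where open ≡-Reasoning

  honeycomb-circulant : Circulant k graph
  honeycomb-circulant = ρ , ρ-isAutomorphism , ρ-semiregular , representative ,
    (λ i → let m , r , reached = orbit (vertex i) in m , r , trans reached (index-vertex i)) , representatives-distinct

proposition1p4 : (k : ℕ) → k % 2 ≡ 1 →
    Σ (Graph (6 ℕ.* k ℕ.^ 2)) λ G →
      Connected G × Cubic G × ArcTransitive G × Circulant k G
-- Oddness is only needed to exclude k = 0.
proposition1p4 zero    ()
proposition1p4 k@(suc _) _ =
  graph , honeycomb-connected , degree-graph , honeycomb-arcTransitive , honeycomb-circulant
  where open Honeycomb k
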